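{- Let $M,N$ be integers with $2\le M<N/2$. For every sequence of integers $0\le n_1<\cdots<n_M\le N$ there exists a positive integer $r\le 2N/(M-1)$ such that $n_{i+1}-n_i=r$ for at least $(M-1)^2/(4N)$ values of $i\in\{1,\ldots,M-1\}$. -}

module Defs where

open import Data.Nat using (ℕ; zero; suc; _+_; _*_; _∸_; _^_; _≤_; _<_)
open import Data.Fin using (Fin; zero; suc; inject₁)
open import Data.Nat.Properties using (_≟_)
open import Relation.Nullary using (yes; no)

-- number of indices i ∈ Fin m (standing for i = 1..m, 0-based) such that
-- the gap a (i+1) - a i equals r, for a sequence a indexed by Fin (suc m).
gapCount : (m : ℕ) → (Fin (suc m) → ℕ) → ℕ → ℕ
gapCount zero    a r = 0
gapCount (suc m) a r with a (suc zero) ∸ a zero ≟ r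
... | yes _ = suc (gapCount m (λ j → a (suc j)) r)
... | no  _ = gapCount m (λ j → a (suc j)) r

{-# OPTIONS --safe #-}
module Submission where

open import Defs
open import Data.Nat using (ℕ; suc; _*_; _^_; _≤_; _<_)
open import Data.Fin using (Fin)
open import Data.Product using (Σ; _×_)

open import Data.Nat using (zero; _+_; _∸_; z≤n; s≤s; NonZero; _≤?_; _≟_)
open import Data.Nat.Properties
open import Data.Nat.DivMod using (_/_; _%_; m/n*n≤m; m≡m%n+[m/n]*n; m%n<n; m≥n⇒m/n>0)
open import Data.Nat.Tactic.RingSolver using (solve-∀)
open import Data.Fin using (inject₁; fromℕ) renaming (zero to fzero; suc to fsuc)
open import Data.Fin.Properties using (toℕ-inject₁)
open import Data.Product using (_,_)
open import Data.Empty using (⊥-elim)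
open import Relation.Nullary using (yes; no)
open import Relation.Binary.PropositionalEquality using (_≡_; refl; sym; trans; cong; module ≡-Reasoning)

-- Write m for the number of gaps and R = ⌊2N/m⌋. A gap larger than R is at least R + 1, and
-- the gaps sum to at most N; since (R + 1) m > 2N, fewer than m/2 gaps can exceed R. So at
-- least m/2 gaps take values in {1, …, R}, and by pigeonhole one value r is taken by at least
-- m/(2R) of them; then m² ≤ 2Rm · #{gaps = r} ≤ 4N · #{gaps = r}.

Seq : ℕ → Set
Seq m = Fin (suc m) → ℕ

tail : ∀ {m} → Seq (suc m) → Seq m
tail a j = a (fsuc j)

firstGap : ∀ {m} → Seq (suc m) → ℕ
firstGap a = a (fsuc fzero) ∸ a fzero

StrictlyIncreasing : (m : ℕ) → Seq m → Set
StrictlyIncreasing m a = (i : Fin m) → a (inject₁ i) < a (fsuc i)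

StrictlyIncreasing-tail : ∀ {m} (a : Seq (suc m)) →
  StrictlyIncreasing (suc m) a → StrictlyIncreasing m (tail a)
StrictlyIncreasing-tail a inc i = inc (fsuc i)

gapSum : (m : ℕ) → Seq m → ℕ
gapSum zero    a = 0
gapSum (suc m) a = firstGap a + gapSum m (tail a)

gapSum-telescopes : ∀ m a → StrictlyIncreasing m a → gapSum m a + a fzero ≡ a (fromℕ m)
gapSum-telescopes zero    a inc = refl
gapSum-telescopes (suc m) a inc = begin
  (firstGap a + gapSum m (tail a)) + a fzero  ≡⟨ cong (_+ a fzero) (+-comm (firstGap a) _) ⟩
  (gapSum m (tail a) + firstGap a) + a fzero  ≡⟨ +-assoc (gapSum m (tail a)) _ _ ⟩
  gapSum m (tail a) + (firstGap a + a fzero)  ≡⟨ cong (gapSum m (tail a) +_) (m∸n+n≡m (<⇒≤ (inc fzero))) ⟩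
  gapSum m (tail a) + tail a fzero            ≡⟨ gapSum-telescopes m (tail a) (StrictlyIncreasing-tail a inc) ⟩
  a (fromℕ (suc m))                           ∎
  where open ≡-Reasoning

gapsAtMost : ℕ → (m : ℕ) → Seq m → ℕ
gapsAtMost R zero    a = 0
gapsAtMost R (suc m) a with firstGap a ≤? R
... | yes _ = suc (gapsAtMost R m (tail a))
... | no  _ = gapsAtMost R m (tail a)

gapsAbove : ℕ → (m : ℕ) → Seq m → ℕ
gapsAbove R zero    a = 0
gapsAbove R (suc m) a with firstGap a ≤? R
... | yes _ = gapsAbove R m (tail a)
... | no  _ = suc (gapsAbove R m (tail a))

gapsAtMost+gapsAbove≡m : ∀ R m a → gapsAtMost R m a + gapsAbove R m a ≡ m
gapsAtMost+gapsAbove≡m R zero    a = refl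
gapsAtMost+gapsAbove≡m R (suc m) a with firstGap a ≤? R
... | yes _ = cong suc (gapsAtMost+gapsAbove≡m R m (tail a))
... | no  _ = trans (+-suc (gapsAtMost R m (tail a)) _) (cong suc (gapsAtMost+gapsAbove≡m R m (tail a)))

gapsAbove*[1+R]≤gapSum : ∀ R m a → gapsAbove R m a * suc R ≤ gapSum m a
gapsAbove*[1+R]≤gapSum R zero    a = z≤n
gapsAbove*[1+R]≤gapSum R (suc m) a with firstGap a ≤? R
... | yes _   = ≤-trans (gapsAbove*[1+R]≤gapSum R m (tail a)) (m≤n+m _ _)
... | no  g≰R = +-mono-≤ (≰⇒> g≰R) (gapsAbove*[1+R]≤gapSum R m (tail a))

m≤2*gapsAtMost : ∀ {N} R m a → StrictlyIncreasing m a → a (fromℕ m) ≤ N →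
  2 * N < suc R * m → m ≤ 2 * gapsAtMost R m a
m≤2*gapsAtMost {N} R m a inc aₘ≤N 2N<[1+R]m = begin
  m      ≡⟨ sym (gapsAtMost+gapsAbove≡m R m a) ⟩
  S + K  ≤⟨ +-monoʳ-≤ S (<⇒≤ K<S) ⟩
  S + S  ≡⟨ cong (S +_) (sym (+-identityʳ S)) ⟩
  2 * S  ∎
  where
  open ≤-Reasoning
  S = gapsAtMost R m a
  K = gapsAbove R m a
  K*[1+R]≤N : K * suc R ≤ N
  K*[1+R]≤N = ≤-trans (gapsAbove*[1+R]≤gapSum R m a)
    (≤-trans (m≤m+n _ _) (≤-trans (≤-reflexive (gapSum-telescopes m a inc)) aₘ≤N))
  2K<m : 2 * K < m
  2K<m = *-cancelˡ-< (suc R) (2 * K) m (begin-strict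
    suc R * (2 * K)  ≡⟨ reorder R K ⟩
    2 * (K * suc R)  ≤⟨ *-monoʳ-≤ 2 K*[1+R]≤N ⟩
    2 * N            <⟨ 2N<[1+R]m ⟩
    suc R * m        ∎)
    where
    reorder : ∀ R K → suc R * (2 * K) ≡ 2 * (K * suc R)
    reorder = solve-∀
  K<S : K < S
  K<S = +-cancelʳ-< K K S (begin-strict
    K + K  ≡⟨ cong (K +_) (sym (+-identityʳ K)) ⟩
    2 * K  <⟨ 2K<m ⟩
    m      ≡⟨ sym (gapsAtMost+gapsAbove≡m R m a) ⟩
    S + K  ∎)

sumTo : (ℕ → ℕ) → ℕ → ℕ
sumTo f zero    = 0
sumTo f (suc R) = f (suc R) + sumTo f R

sumTo-mono : ∀ {f g} R → (∀ s → f s ≤ g s) → sumTo f R ≤ sumTo g R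
sumTo-mono zero    f≤g = z≤n
sumTo-mono (suc R) f≤g = +-mono-≤ (f≤g (suc R)) (sumTo-mono R f≤g)

sumTo-mono-< : ∀ {f g} {t} R → (∀ s → f s ≤ g s) → 1 ≤ t → t ≤ R → f t < g t →
  sumTo f R < sumTo g R
sumTo-mono-< zero    _ (s≤s _) () _
sumTo-mono-< {t = t} (suc R) f≤g 1≤t t≤1+R ft<gt with t ≟ suc R
... | yes refl = +-mono-<-≤ ft<gt (sumTo-mono R f≤g)
... | no  t≢1+R = +-mono-≤-< (f≤g (suc R))
  (sumTo-mono-< R f≤g 1≤t (≤-pred (≤∧≢⇒< t≤1+R t≢1+R)) ft<gt)

sumTo≤R*max : ∀ (f : ℕ → ℕ) R → 1 ≤ R → Σ ℕ (λ r → 1 ≤ r × r ≤ R × sumTo f R ≤ R * f r)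
sumTo≤R*max f (suc zero)    _ = 1 , ≤-refl , ≤-refl , ≤-refl
sumTo≤R*max f (suc (suc R)) _ with sumTo≤R*max f (suc R) (s≤s z≤n)
... | r , 1≤r , r≤1+R , Σ≤[1+R]fr with f (suc (suc R)) ≤? f r
...   | yes f[2+R]≤fr = r , 1≤r , m≤n⇒m≤1+n r≤1+R , +-mono-≤ f[2+R]≤fr Σ≤[1+R]fr
...   | no  f[2+R]≰fr = suc (suc R) , s≤s z≤n , ≤-refl ,
        +-monoʳ-≤ (f (suc (suc R))) (≤-trans Σ≤[1+R]fr (*-monoʳ-≤ (suc R) (<⇒≤ (≰⇒> f[2+R]≰fr))))

gapCount-tail≤ : ∀ m a s → gapCount m (tail a) s ≤ gapCount (suc m) a s
gapCount-tail≤ m a s with firstGap a ≟ s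
... | yes _ = n≤1+n _
... | no  _ = ≤-refl

gapCount-tail<-firstGap : ∀ m a → gapCount m (tail a) (firstGap a) < gapCount (suc m) a (firstGap a)
gapCount-tail<-firstGap m a with firstGap a ≟ firstGap a
... | yes _ = ≤-refl
... | no  g≢g = ⊥-elim (g≢g refl)

gapsAtMost≤sumTo-gapCount : ∀ R m a → StrictlyIncreasing m a →
  gapsAtMost R m a ≤ sumTo (gapCount m a) R
gapsAtMost≤sumTo-gapCount R zero    a inc = z≤n
gapsAtMost≤sumTo-gapCount R (suc m) a inc with firstGap a ≤? R
... | yes g≤R = ≤-trans (s≤s IH) (sumTo-mono-< R (gapCount-tail≤ m a)
                  (m<n⇒0<n∸m (inc fzero)) g≤R (gapCount-tail<-firstGap m a))
  where IH = gapsAtMost≤sumTo-gapCount R m (tail a) (StrictlyIncreasing-tail a inc)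
... | no  _   = ≤-trans (gapsAtMost≤sumTo-gapCount R m (tail a) (StrictlyIncreasing-tail a inc))
                  (sumTo-mono R (gapCount-tail≤ m a))

<-monotone⇒StrictlyIncreasing : ∀ m (a : Seq m) →
  (∀ i j → i Data.Fin.< j → a i < a j) → StrictlyIncreasing m a
<-monotone⇒StrictlyIncreasing m a mono i = mono (inject₁ i) (fsuc i) (s≤s (≤-reflexive (toℕ-inject₁ i)))

m<[1+m/n]*n : ∀ m n .{{_ : NonZero n}} → m < suc (m / n) * n
m<[1+m/n]*n m n = begin-strict
  m                  ≡⟨ m≡m%n+[m/n]*n m n ⟩
  m % n + m / n * n  <⟨ +-monoˡ-< (m / n * n) (m%n<n m n) ⟩
  suc (m / n) * n    ∎
  where open ≤-Reasoning

m²≤4Nc : ∀ {m S c} N R → m ≤ 2 * S → S ≤ R * c → R * m ≤ 2 * N → m ^ 2 ≤ 4 * N * c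
m²≤4Nc {m} {S} {c} N R m≤2S S≤Rc Rm≤2N = begin
  m ^ 2            ≡⟨ cong (m *_) (*-identityʳ m) ⟩
  m * m            ≤⟨ *-monoˡ-≤ m (≤-trans m≤2S (*-monoʳ-≤ 2 S≤Rc)) ⟩
  2 * (R * c) * m  ≡⟨ reorder R c m ⟩
  2 * c * (R * m)  ≤⟨ *-monoʳ-≤ (2 * c) Rm≤2N ⟩
  2 * c * (2 * N)  ≡⟨ reorder′ c N ⟩
  4 * N * c        ∎
  where
  open ≤-Reasoning
  reorder : ∀ R c m → 2 * (R * c) * m ≡ 2 * c * (R * m)
  reorder = solve-∀
  reorder′ : ∀ c N → 2 * c * (2 * N) ≡ 4 * N * c
  reorder′ = solve-∀

lemma5p7 : (m N : ℕ) → 2 ≤ suc m → 2 * suc m < N →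
    (n : Fin (suc m) → ℕ) →
    (∀ i j → i Data.Fin.< j → n i < n j) →
    (∀ i → n i ≤ N) →
    Σ ℕ (λ r → 1 ≤ r × r * m ≤ 2 * N × m ^ 2 ≤ 4 * N * gapCount m n r)
lemma5p7 zero N (s≤s ()) _ _ _ _
lemma5p7 m@(suc _) N _ 2[1+m]<N n n-mono n≤N =
  let r , 1≤r , r≤R , Σ≤R*c = sumTo≤R*max (gapCount m n) R 1≤R
  in r , 1≤r , ≤-trans (*-monoˡ-≤ m r≤R) Rm≤2N ,
     m²≤4Nc N R m≤2S (≤-trans (gapsAtMost≤sumTo-gapCount R m n inc) Σ≤R*c) Rm≤2N
  where
  R = 2 * N / m
  Rm≤2N : R * m ≤ 2 * N
  Rm≤2N = m/n*n≤m (2 * N) m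
  1≤R : 1 ≤ R
  1≤R = m≥n⇒m/n>0 (≤-trans (n≤1+n m)
          (≤-trans (m≤n*m (suc m) 2) (≤-trans (<⇒≤ 2[1+m]<N) (m≤n*m N 2))))
  inc : StrictlyIncreasing m n
  inc = <-monotone⇒StrictlyIncreasing m n n-mono
  m≤2S : m ≤ 2 * gapsAtMost R m n
  m≤2S = m≤2*gapsAtMost R m n inc (n≤N (fromℕ m)) (m<[1+m/n]*n (2 * N) m)
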